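{- For all integers $n > 2$, $f(n) \le \bar f(n)$, where $\bar f$ is the function defined below.
   Context: A family $\mathcal{F}$ of subsets of a set is $2$-laminar if whenever $A,B \in \mathcal{F}$ satisfy $|A \cap B| \ge 2$, we have $A \subseteq B$ or $B \subseteq A$. For a positive integer $n$, $f(n)$ denotes the maximum of $|\{A \in \mathcal{F} : |A| \ge 2\}|$ over all $2$-laminar families $\mathcal{F}$ of subsets of $[n]=\{1,\dots,n\}$. Define $\bar f:\mathbb{Z}_{\ge 2}\to\mathbb{Q}$ recursively by $\bar f(2)=1$, $\bar f(3)=4$, and for $n>3$, $\bar f(n) = 1 + \max_{2 \le m < n} \mathrm{LP}(n,m)$, where $\mathrm{LP}(n,m)$ is the optimal value of the linear program in real variables $b_2,\dots,b_m$: maximize $\sum_{2\le k\le m} \bar f(k)\, b_k$ subject to $b_m \ge 1$; $b_k \ge 0$ for $2 \le k < m$; $\sum_{2 \le k \le m}\binom{k}{2} b_k \le \binom{n}{2}$; and $\sum_{2\le k\le m}\binom{k-1}{2} b_k \le \binom{n-m}{2}+\binom{m-1}{2}$. -}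

module Defs where

open import Data.Nat as ℕ using (ℕ; zero; suc; _∸_; _≤ᵇ_)
open import Data.Nat.Combinatorics using (_C_)
open import Data.Integer using (+_)
open import Data.Rational using (ℚ; _/_; _+_; _*_; _≤_; 0ℚ; 1ℚ)
open import Data.Bool using (if_then_else_)
open import Data.Fin.Subset using (Subset; _∩_; _⊆_; ∣_∣)
open import Data.List using (List; []; _∷_)
open import Data.List.Membership.Propositional using (_∈_)
open import Data.List.Relation.Unary.Unique.Propositional using (Unique)
open import Data.Product using (Σ; _×_; ∃)
open import Data.Sum using (_⊎_)
open import Relation.Binary.PropositionalEquality using (_≡_)

record Family (n : ℕ) : Set where
  field
    sets     : List (Subset n)
    distinct : Unique sets
open Family public

TwoLaminar : {n : ℕ} → Family n → Set
TwoLaminar F = ∀ A B → A ∈ sets F → B ∈ sets F →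
  2 ℕ.≤ ∣ A ∩ B ∣ → (A ⊆ B) ⊎ (B ⊆ A)

countBig : {n : ℕ} → List (Subset n) → ℕ
countBig []      = 0
countBig (A ∷ F) = if 2 ≤ᵇ ∣ A ∣ then suc (countBig F) else countBig F

bigCount : {n : ℕ} → Family n → ℕ
bigCount F = countBig (sets F)

toℚ : ℕ → ℚ
toℚ k = + k / 1

sum2to : ℕ → (ℕ → ℚ) → ℚ
sum2to zero          g = 0ℚ
sum2to (suc zero)    g = 0ℚ
sum2to (suc (suc j)) g = sum2to (suc j) g + g (suc (suc j))

-- feasibility of b = (b_2, …, b_m) (only the entries b k, 2 ≤ k ≤ m, matter)
Feasible : ℕ → ℕ → (ℕ → ℚ) → Set
Feasible n m b =
    (1ℚ ≤ b m)
  × (∀ k → 2 ℕ.≤ k → k ℕ.< m → 0ℚ ≤ b k)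
  × (sum2to m (λ k → toℚ (k C 2) * b k) ≤ toℚ (n C 2))
  × (sum2to m (λ k → toℚ ((k ∸ 1) C 2) * b k)
        ≤ toℚ ((n ∸ m) C 2) + toℚ ((m ∸ 1) C 2))

Objective : (ℕ → ℚ) → ℕ → (ℕ → ℚ) → ℚ
Objective g m b = sum2to m (λ k → g k * b k)

IsMaxLP : (ℕ → ℚ) → ℕ → ℚ → Set
IsMaxLP g n v =
    (Σ ℕ λ m → 2 ℕ.≤ m × m ℕ.< n ×
       Σ (ℕ → ℚ) λ b → Feasible n m b × v ≡ 1ℚ + Objective g m b)
  × (∀ m → 2 ℕ.≤ m → m ℕ.< n → ∀ b → Feasible n m b →
       1ℚ + Objective g m b ≤ v)

IsFbar : (ℕ → ℚ) → Set
IsFbar g = (g 2 ≡ 1ℚ) × (g 3 ≡ toℚ 4) × (∀ n → 3 ℕ.< n → IsMaxLP g n (g n))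

-- Induction on the ground set S. Call a member big if it has at least two points. The
-- maximal big members other than S pairwise share at most one point (two sharing two points
-- would be nested, by 2-laminarity), and every other big member lies below one of them, so
-- the count is at most 1 + Σ_A f̄(|A|) over these maximal members A, by induction. Their
-- sizes define a feasible point of LP(|S|, m), m the largest size: counting pairs gives
-- Σ C(|A|,2) ≤ C(|S|,2), and deleting a largest member A₁ from the others costs each at most
-- one point and leaves a family of the same kind on S ∖ A₁, so
-- Σ C(|A|-1,2) ≤ C(|A₁|-1,2) + C(|S|-|A₁|,2). Hence 1 + Σ_A f̄(|A|) ≤ f̄(|S|).

module Submission where

open import Defs

open import Algebra.Bundles using (CommutativeMonoid)
import Algebra.Properties.CommutativeSemigroup as CommSemigroupProperties
open import Data.Bool using (true; false; T; _∧_; if_then_else_)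
import Data.Bool.Properties as Bool
open import Data.Fin.Subset using (Subset; _∩_; _⊆_; _─_; ∣_∣; ⊤; inside; outside)
open import Data.Fin.Subset.Properties
  using ( _⊆?_; ⊆⊤; ⊆-antisym; drop-∷-⊆; out⊆; s⊆s; p∩q⊆q; x∈p∩q⁺; x∈p∩q⁻; ∩-comm; p─q⊆p
        ; ∣p∣≤n; ∣⊤∣≡n; p⊆q⇒∣p∣≤∣q∣; ∣p∣≤∣x∷p∣)
import Data.Integer as ℤ
import Data.Integer.Properties as ℤₚ
open import Data.List using (List; []; _∷_; map; foldr; filter)
open import Data.List.Extrema.Nat using (argmax; argmax-all; f[⊥]≤f[argmax]; f[xs]≤f[argmax])
open import Data.List.Membership.Propositional using (_∈_; lose; find)
open import Data.List.Membership.Propositional.Properties using (∈-filter⁺; ∈-filter⁻; ∈-map⁺)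
open import Data.List.Properties using (map-∘; map-cong-local)
open import Data.List.Relation.Unary.All as All using (All; []; _∷_)
import Data.List.Relation.Unary.All.Properties as Allₚ
open import Data.List.Relation.Unary.AllPairs as AllPairs using (AllPairs; []; _∷_)
import Data.List.Relation.Unary.AllPairs.Properties as AllPairsₚ
open import Data.List.Relation.Unary.Any as Any using (Any; here; there; any?)
open import Data.List.Relation.Unary.Unique.Propositional using (Unique)
import Data.List.Relation.Unary.Unique.Propositional.Properties as Uniqueₚ
open import Data.Nat
  using (ℕ; zero; suc; _+_; _∸_; _≤_; _<_; _≤′_; z≤n; s≤s; s≤s⁻¹; ≤′-refl; ≤′-step; _≡ᵇ_; _≤ᵇ_; _≤?_)
open import Data.Nat.Combinatorics using (_C_) renaming (nCk+nC[k+1]≡[n+1]C[k+1] to pascal)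
import Data.Nat.Coprimality as Coprime
open import Data.Nat.Induction using (<-wellFounded)
open import Data.Nat.ListAction using (sum)
open import Data.Nat.Properties
open import Data.Product using (_×_; _,_; proj₁; proj₂)
import Data.Rational as ℚ
open import Data.Rational using (ℚ; 0ℚ; 1ℚ)
import Data.Rational.Properties as ℚₚ
open import Data.Sum using (_⊎_; inj₁; inj₂; [_,_])
open import Data.Vec using (_∷_; []; tail)
import Data.Vec as Vec
open import Data.Vec.Properties using (≡-dec)
open import Function using (_∘_; id)
open import Induction.WellFounded using (Acc; acc)
open import Relation.Binary.PropositionalEquality
  using (_≡_; _≢_; refl; sym; trans; cong; cong₂; subst; subst₂; module ≡-Reasoning)
open import Relation.Nullary using (¬_; Dec; yes; no; does; contradiction; _×-dec_; ¬?)

open CommSemigroupProperties +-commutativeSemigroup using (interchange; x∙yz≈y∙xz)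
open CommSemigroupProperties (CommutativeMonoid.commutativeSemigroup ℚₚ.+-0-commutativeMonoid)
  using () renaming (interchange to ℚ-interchange)

nCk≤[1+n]Ck : ∀ n k → n C k ≤ suc n C k
nCk≤[1+n]Ck n zero    = ≤-refl
nCk≤[1+n]Ck n (suc k) = subst (n C suc k ≤_) (pascal n k) (m≤n+m (n C suc k) (n C k))

C-monoˡ-≤ : ∀ k {m n} → m ≤ n → m C k ≤ n C k
C-monoˡ-≤ k {m} m≤n = go (≤⇒≤′ m≤n)
  where
  go : ∀ {n} → m ≤′ n → m C k ≤ n C k
  go ≤′-refl     = ≤-refl
  go (≤′-step p) = ≤-trans (go p) (nCk≤[1+n]Ck _ k)

_≟ₛ_ : ∀ {n} (A B : Subset n) → Dec (A ≡ B)
_≟ₛ_ = ≡-dec Bool._≟_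

∣p∩q∣+∣p─q∣≡∣p∣ : ∀ {n} (p q : Subset n) → ∣ p ∩ q ∣ + ∣ p ─ q ∣ ≡ ∣ p ∣
∣p∩q∣+∣p─q∣≡∣p∣ []            []            = refl
∣p∩q∣+∣p─q∣≡∣p∣ (inside ∷ p)  (inside ∷ q)  = cong suc (∣p∩q∣+∣p─q∣≡∣p∣ p q)
∣p∩q∣+∣p─q∣≡∣p∣ (inside ∷ p)  (outside ∷ q) = trans (+-suc _ _) (cong suc (∣p∩q∣+∣p─q∣≡∣p∣ p q))
∣p∩q∣+∣p─q∣≡∣p∣ (outside ∷ p) (inside ∷ q)  = ∣p∩q∣+∣p─q∣≡∣p∣ p q
∣p∩q∣+∣p─q∣≡∣p∣ (outside ∷ p) (outside ∷ q) = ∣p∩q∣+∣p─q∣≡∣p∣ p q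

q⊆p⇒p∩q≡q : ∀ {n} {p q : Subset n} → q ⊆ p → p ∩ q ≡ q
q⊆p⇒p∩q≡q {p = p} {q} q⊆p = ⊆-antisym (p∩q⊆q p q) (λ x∈q → x∈p∩q⁺ (q⊆p x∈q , x∈q))

q⊆p⇒∣p─q∣≡∣p∣∸∣q∣ : ∀ {n} {p q : Subset n} → q ⊆ p → ∣ p ─ q ∣ ≡ ∣ p ∣ ∸ ∣ q ∣
q⊆p⇒∣p─q∣≡∣p∣∸∣q∣ {p = p} {q} q⊆p = begin
  ∣ p ─ q ∣                       ≡⟨ m+n∸m≡n ∣ q ∣ ∣ p ─ q ∣ ⟨
  ∣ q ∣ + ∣ p ─ q ∣ ∸ ∣ q ∣       ≡⟨ cong (λ r → ∣ r ∣ + ∣ p ─ q ∣ ∸ ∣ q ∣) (q⊆p⇒p∩q≡q q⊆p) ⟨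
  ∣ p ∩ q ∣ + ∣ p ─ q ∣ ∸ ∣ q ∣   ≡⟨ cong (_∸ ∣ q ∣) (∣p∩q∣+∣p─q∣≡∣p∣ p q) ⟩
  ∣ p ∣ ∸ ∣ q ∣                   ∎
  where open ≡-Reasoning

─-monoˡ-⊆ : ∀ {n} {p q : Subset n} (r : Subset n) → p ⊆ q → p ─ r ⊆ q ─ r
─-monoˡ-⊆ {p = []}          {[]}          []            p⊆q = p⊆q
─-monoˡ-⊆ {p = _ ∷ p}       {_ ∷ q}       (inside ∷ r)  p⊆q = out⊆ (─-monoˡ-⊆ r (drop-∷-⊆ p⊆q))
─-monoˡ-⊆ {p = outside ∷ p} {_ ∷ q}       (outside ∷ r) p⊆q = out⊆ (─-monoˡ-⊆ r (drop-∷-⊆ p⊆q))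
─-monoˡ-⊆ {p = inside ∷ p}  {inside ∷ q}  (outside ∷ r) p⊆q = s⊆s (─-monoˡ-⊆ r (drop-∷-⊆ p⊆q))
─-monoˡ-⊆ {p = inside ∷ p}  {outside ∷ q} (outside ∷ r) p⊆q with p⊆q Vec.here
... | ()

p⊆q∧p≢q⇒∣p∣<∣q∣ : ∀ {n} {p q : Subset n} → p ⊆ q → p ≢ q → ∣ p ∣ < ∣ q ∣
p⊆q∧p≢q⇒∣p∣<∣q∣ {p = []}          {[]}          _   p≢q = contradiction refl p≢q
p⊆q∧p≢q⇒∣p∣<∣q∣ {p = outside ∷ p} {inside ∷ q}  p⊆q _   = s≤s (p⊆q⇒∣p∣≤∣q∣ (drop-∷-⊆ p⊆q))
p⊆q∧p≢q⇒∣p∣<∣q∣ {p = outside ∷ p} {outside ∷ q} p⊆q p≢q =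
  p⊆q∧p≢q⇒∣p∣<∣q∣ (drop-∷-⊆ p⊆q) (p≢q ∘ cong (outside ∷_))
p⊆q∧p≢q⇒∣p∣<∣q∣ {p = inside ∷ p}  {inside ∷ q}  p⊆q p≢q =
  s≤s (p⊆q∧p≢q⇒∣p∣<∣q∣ (drop-∷-⊆ p⊆q) (p≢q ∘ cong (inside ∷_)))
p⊆q∧p≢q⇒∣p∣<∣q∣ {p = inside ∷ p}  {outside ∷ q} p⊆q _   with p⊆q Vec.here
... | ()

sum-map-mono-≤ : ∀ {X : Set} {f g : X → ℕ} {xs} → All (λ x → f x ≤ g x) xs → sum (map f xs) ≤ sum (map g xs)
sum-map-mono-≤ []           = z≤n
sum-map-mono-≤ (fx≤gx ∷ le) = +-mono-≤ fx≤gx (sum-map-mono-≤ le)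

sum-map-mono-< : ∀ {X : Set} {f g : X → ℕ} {xs} → All (λ x → f x ≤ g x) xs →
  Any (λ x → f x < g x) xs → sum (map f xs) < sum (map g xs)
sum-map-mono-< (_     ∷ le) (here fx<gx)    = +-mono-<-≤ fx<gx (sum-map-mono-≤ le)
sum-map-mono-< (fx≤gx ∷ le) (there fxs<gxs) = +-mono-≤-< fx≤gx (sum-map-mono-< le fxs<gxs)

sum-≤-except : ∀ {X : Set} {R : X → X → Set} (f g : X → ℕ) {xs a} → AllPairs R xs → a ∈ xs →
  (∀ {x} → R x a ⊎ R a x → f x ≤ g x) → sum (map f xs) ≤ f a + sum (map g xs)
sum-≤-except f g {x ∷ xs} (Rx ∷ ps) (here refl) f≤g =
  +-monoʳ-≤ (f x) (≤-trans (sum-map-mono-≤ (All.map (f≤g ∘ inj₂) Rx)) (m≤n+m _ (g x)))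
sum-≤-except f g {x ∷ xs} {a} (Rx ∷ ps) (there a∈xs) f≤g = begin
  f x + sum (map f xs)           ≤⟨ +-mono-≤ (f≤g (inj₁ (All.lookup Rx a∈xs))) (sum-≤-except f g ps a∈xs f≤g) ⟩
  g x + (f a + sum (map g xs))   ≡⟨ x∙yz≈y∙xz (g x) (f a) _ ⟩
  f a + (g x + sum (map g xs))   ∎
  where open ≤-Reasoning

AllPairs-mapWith : ∀ {X : Set} {P : X → Set} {Q R : X → X → Set} →
  (∀ {x y} → P x → P y → Q x y → R x y) → ∀ {xs} → All P xs → AllPairs Q xs → AllPairs R xs
AllPairs-mapWith f []         []         = []
AllPairs-mapWith f (px ∷ pxs) (qx ∷ qxs) =
  All.zipWith (λ (py , qxy) → f px py qxy) (pxs , qx) ∷ AllPairs-mapWith f pxs qxs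

-- Packing bounds

MeetAtMost : ∀ {n} → ℕ → Subset n → Subset n → Set
MeetAtMost t A B = ∣ A ∩ B ∣ ≤ t

sumC : ∀ {n} → ℕ → List (Subset n) → ℕ
sumC k M = sum (map (λ A → ∣ A ∣ C k) M)

link : ∀ {n} → List (Subset (suc n)) → List (Subset n)
link []                  = []
link ((inside ∷ A) ∷ M)  = A ∷ link M
link ((outside ∷ A) ∷ M) = link M

module _ {n : ℕ} where

  sumC-link-tails : ∀ t (M : List (Subset (suc n))) →
    sumC (suc t) M ≡ sumC t (link M) + sumC (suc t) (map tail M)
  sumC-link-tails t []                  = refl
  sumC-link-tails t ((inside ∷ A) ∷ M)  = begin
    suc ∣ A ∣ C suc t + sumC (suc t) M
      ≡⟨ cong₂ _+_ (sym (pascal ∣ A ∣ t)) (sumC-link-tails t M) ⟩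
    (∣ A ∣ C t + ∣ A ∣ C suc t) + (sumC t (link M) + sumC (suc t) (map tail M))
      ≡⟨ interchange (∣ A ∣ C t) (∣ A ∣ C suc t) (sumC t (link M)) _ ⟩
    (∣ A ∣ C t + sumC t (link M)) + (∣ A ∣ C suc t + sumC (suc t) (map tail M))
      ∎
    where open ≡-Reasoning
  sumC-link-tails t ((outside ∷ A) ∷ M) =
    trans (cong (∣ A ∣ C suc t +_) (sumC-link-tails t M)) (x∙yz≈y∙xz (∣ A ∣ C suc t) (sumC t (link M)) _)

  tails-meetAtMost : ∀ {t} {M : List (Subset (suc n))} →
    AllPairs (MeetAtMost t) M → AllPairs (MeetAtMost t) (map tail M)
  tails-meetAtMost = AllPairsₚ.map⁺ ∘ AllPairs.map (λ {A} {B} → ≤-trans (∣tail∩tail∣≤∣∩∣ A B))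
    where
    ∣tail∩tail∣≤∣∩∣ : ∀ (A B : Subset (suc n)) → ∣ tail A ∩ tail B ∣ ≤ ∣ A ∩ B ∣
    ∣tail∩tail∣≤∣∩∣ (a ∷ A) (b ∷ B) = ∣p∣≤∣x∷p∣ (a ∧ b) (A ∩ B)

  tails-⊆ : ∀ {s S} {M : List (Subset (suc n))} → All (_⊆ s ∷ S) M → All (_⊆ S) (map tail M)
  tails-⊆ = Allₚ.map⁺ ∘ All.map tail-⊆
    where
    tail-⊆ : ∀ {s S} {A : Subset (suc n)} → A ⊆ s ∷ S → tail A ⊆ S
    tail-⊆ {A = a ∷ A} = drop-∷-⊆

  link-⊆ : ∀ {s S} {M : List (Subset (suc n))} → All (_⊆ s ∷ S) M → All (_⊆ S) (link M)
  link-⊆ {M = []}                  []       = []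
  link-⊆ {M = (inside ∷ A) ∷ M}    (h ∷ hs) = drop-∷-⊆ h ∷ link-⊆ hs
  link-⊆ {M = (outside ∷ A) ∷ M}   (_ ∷ hs) = link-⊆ hs

  link-outside : ∀ {S} {M : List (Subset (suc n))} → All (_⊆ outside ∷ S) M → link M ≡ []
  link-outside {M = []}                []       = refl
  link-outside {M = (outside ∷ A) ∷ M} (_ ∷ hs) = link-outside hs
  link-outside {M = (inside ∷ A) ∷ M}  (h ∷ _) with h Vec.here
  ... | ()

  link-meetAtMost : ∀ {t} {M : List (Subset (suc n))} →
    AllPairs (MeetAtMost (suc t)) M → AllPairs (MeetAtMost t) (link M)
  link-meetAtMost {M = []}                  []       = []
  link-meetAtMost {M = (outside ∷ A) ∷ M}   (_ ∷ ps) = link-meetAtMost ps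
  link-meetAtMost {M = (inside ∷ A) ∷ M}    (h ∷ ps) = meets h ∷ link-meetAtMost ps
    where
    meets : ∀ {t M} → All (MeetAtMost (suc t) (inside ∷ A)) M → All (MeetAtMost t A) (link M)
    meets {M = []}                []           = []
    meets {M = (outside ∷ B) ∷ M} (_ ∷ hs)     = meets hs
    meets {M = (inside ∷ B) ∷ M}  (s≤s h ∷ hs) = h ∷ meets hs

  link-disjoint : ∀ {M : List (Subset (suc n))} → AllPairs (MeetAtMost 0) M → sumC 0 (link M) ≤ 1
  link-disjoint {M = []}                []       = z≤n
  link-disjoint {M = (outside ∷ A) ∷ M} (_ ∷ ps) = link-disjoint ps
  link-disjoint {M = (inside ∷ A) ∷ M}  (h ∷ _)  = s≤s (≤-reflexive (cong (sumC 0) (avoids h)))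
    where
    avoids : ∀ {M} → All (MeetAtMost 0 (inside ∷ A)) M → link M ≡ []
    avoids {M = []}                []       = refl
    avoids {M = (outside ∷ B) ∷ M} (_ ∷ hs) = avoids hs
    avoids {M = (inside ∷ B) ∷ M}  (() ∷ _)

-- Pascal's rule splits C(|A|, t+1) according to whether A contains the first point; the
-- members that do, with that point removed (the link), pairwise meet in at most t - 1
-- points, and there is at most one of them when t = 0.
packing-bound : ∀ {n} t (S : Subset n) {M} → AllPairs (MeetAtMost t) M → All (_⊆ S) M →
  sumC (suc t) M ≤ ∣ S ∣ C suc t
packing-bound t []            {[]}     _        _        = z≤n
packing-bound t []            {[] ∷ M} (_ ∷ ps) (_ ∷ hs) = packing-bound t [] ps hs
packing-bound t (outside ∷ S) {M}      ps       hs       = begin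
  sumC (suc t) M                                ≡⟨ sumC-link-tails t M ⟩
  sumC t (link M) + sumC (suc t) (map tail M)   ≡⟨ cong (λ L → sumC t L + sumC (suc t) (map tail M)) (link-outside hs) ⟩
  sumC (suc t) (map tail M)                     ≤⟨ packing-bound t S (tails-meetAtMost ps) (tails-⊆ hs) ⟩
  ∣ S ∣ C suc t                                 ∎
  where open ≤-Reasoning
packing-bound t (inside ∷ S)  {M}      ps       hs       = begin
  sumC (suc t) M                                ≡⟨ sumC-link-tails t M ⟩
  sumC t (link M) + sumC (suc t) (map tail M)   ≤⟨ +-mono-≤ (link-bound t ps)
                                                     (packing-bound t S (tails-meetAtMost ps) (tails-⊆ hs)) ⟩
  ∣ S ∣ C t + ∣ S ∣ C suc t                     ≡⟨ pascal ∣ S ∣ t ⟩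
  suc ∣ S ∣ C suc t                             ∎
  where
  open ≤-Reasoning
  link-bound : ∀ t → AllPairs (MeetAtMost t) M → sumC t (link M) ≤ ∣ S ∣ C t
  link-bound zero    ps = link-disjoint ps
  link-bound (suc t) ps = packing-bound t S (link-meetAtMost ps) (link-⊆ hs)

residual-packing-bound : ∀ {n} (S : Subset n) {M A₁} → AllPairs (MeetAtMost 1) M → All (_⊆ S) M → A₁ ∈ M →
  sum (map (λ A → (∣ A ∣ ∸ 1) C 2) M) ≤ (∣ S ∣ ∸ ∣ A₁ ∣) C 2 + (∣ A₁ ∣ ∸ 1) C 2
residual-packing-bound S {M} {A₁} ps hs A₁∈M = begin
  sum (map (λ A → (∣ A ∣ ∸ 1) C 2) M)
    ≤⟨ sum-≤-except _ (λ A → ∣ A ─ A₁ ∣ C 2) ps A₁∈M (C-monoˡ-≤ 2 ∘ pred≤∣─A₁∣) ⟩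
  (∣ A₁ ∣ ∸ 1) C 2 + sum (map (λ A → ∣ A ─ A₁ ∣ C 2) M)
    ≡⟨ cong (λ k → (∣ A₁ ∣ ∸ 1) C 2 + sum k) (map-∘ M) ⟩
  (∣ A₁ ∣ ∸ 1) C 2 + sumC 2 (map (_─ A₁) M)
    ≤⟨ +-monoʳ-≤ _ (packing-bound 1 (S ─ A₁) residues-meet residues-⊆) ⟩
  (∣ A₁ ∣ ∸ 1) C 2 + ∣ S ─ A₁ ∣ C 2
    ≡⟨ +-comm ((∣ A₁ ∣ ∸ 1) C 2) _ ⟩
  ∣ S ─ A₁ ∣ C 2 + (∣ A₁ ∣ ∸ 1) C 2
    ≡⟨ cong (λ k → k C 2 + (∣ A₁ ∣ ∸ 1) C 2) (q⊆p⇒∣p─q∣≡∣p∣∸∣q∣ (All.lookup hs A₁∈M)) ⟩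
  (∣ S ∣ ∸ ∣ A₁ ∣) C 2 + (∣ A₁ ∣ ∸ 1) C 2
    ∎
  where
  open ≤-Reasoning
  pred≤∣─A₁∣ : ∀ {A} → MeetAtMost 1 A A₁ ⊎ MeetAtMost 1 A₁ A → ∣ A ∣ ∸ 1 ≤ ∣ A ─ A₁ ∣
  pred≤∣─A₁∣ {A} meet = m≤n+o⇒m∸n≤o ∣ A ∣ 1 (begin
    ∣ A ∣                       ≡⟨ ∣p∩q∣+∣p─q∣≡∣p∣ A A₁ ⟨
    ∣ A ∩ A₁ ∣ + ∣ A ─ A₁ ∣     ≤⟨ +-monoˡ-≤ ∣ A ─ A₁ ∣ ∣A∩A₁∣≤1 ⟩
    1 + ∣ A ─ A₁ ∣              ∎)
    where
    ∣A∩A₁∣≤1 : ∣ A ∩ A₁ ∣ ≤ 1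
    ∣A∩A₁∣≤1 = [ id , subst (_≤ 1) (cong ∣_∣ (∩-comm A₁ A)) ] meet
  residues-meet : AllPairs (MeetAtMost 1) (map (_─ A₁) M)
  residues-meet = AllPairsₚ.map⁺ (AllPairs.map (λ {A} {B} → ≤-trans (p⊆q⇒∣p∣≤∣q∣ (∩-─-⊆ A B))) ps)
    where
    ∩-─-⊆ : ∀ A B → (A ─ A₁) ∩ (B ─ A₁) ⊆ A ∩ B
    ∩-─-⊆ A B x∈ with x∈p∩q⁻ (A ─ A₁) (B ─ A₁) x∈
    ... | x∈A─A₁ , x∈B─A₁ = x∈p∩q⁺ (p─q⊆p A A₁ x∈A─A₁ , p─q⊆p B A₁ x∈B─A₁)
  residues-⊆ : All (_⊆ S ─ A₁) (map (_─ A₁) M)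
  residues-⊆ = Allₚ.map⁺ (All.map (─-monoˡ-⊆ A₁) hs)

_↾_ : ∀ {n} → Family n → Subset n → Family n
F ↾ A = record { sets = filter (_⊆? A) (sets F) ; distinct = Uniqueₚ.filter⁺ (_⊆? A) (distinct F) }

↾-⊆ : ∀ {n} (F : Family n) {A} → All (_⊆ A) (sets (F ↾ A))
↾-⊆ F {A} = Allₚ.all-filter (_⊆? A) (sets F)

↾-twoLaminar : ∀ {n} {F : Family n} {A} → TwoLaminar F → TwoLaminar (F ↾ A)
↾-twoLaminar {F = F} {A} laminar X Y X∈ Y∈ =
  laminar X Y (proj₁ (∈-filter⁻ (_⊆? A) X∈)) (proj₁ (∈-filter⁻ (_⊆? A) Y∈))

module MaximalMembers {n : ℕ} (S : Subset n) (F : Family n) where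

  BigProper : Subset n → Set
  BigProper A = 2 ≤ ∣ A ∣ × A ≢ S

  _⊏_ : Subset n → Subset n → Set
  A ⊏ C = A ⊆ C × A ≢ C × C ≢ S

  _⊏?_ : ∀ A C → Dec (A ⊏ C)
  A ⊏? C = (A ⊆? C) ×-dec ¬? (A ≟ₛ C) ×-dec ¬? (C ≟ₛ S)

  Maximal : Subset n → Set
  Maximal A = BigProper A × ¬ Any (A ⊏_) (sets F)

  maximal? : ∀ A → Dec (Maximal A)
  maximal? A = ((2 ≤? ∣ A ∣) ×-dec ¬? (A ≟ₛ S)) ×-dec ¬? (any? (A ⊏?_) (sets F))

  maximals : List (Subset n)
  maximals = filter maximal? (sets F)

  ∈-maximals⁻ : ∀ {A} → A ∈ maximals → A ∈ sets F × Maximal A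
  ∈-maximals⁻ = ∈-filter⁻ maximal?

  below-maximal : ∀ {B} → B ∈ sets F → BigProper B → Any (B ⊆_) maximals
  below-maximal {B} B∈F bigProper = climb B (<-wellFounded (n ∸ ∣ B ∣)) B∈F bigProper (λ x∈B → x∈B)
    where
    climb : ∀ C → Acc _<_ (n ∸ ∣ C ∣) → C ∈ sets F → BigProper C → B ⊆ C → Any (B ⊆_) maximals
    climb C (acc rec) C∈F (2≤∣C∣ , C≢S) B⊆C with any? (C ⊏?_) (sets F)
    ... | no  none  = lose (∈-filter⁺ maximal? C∈F ((2≤∣C∣ , C≢S) , none)) (λ {x} → B⊆C {x})
    ... | yes above with find above
    ...   | D , D∈F , C⊆D , C≢D , D≢S = climb D (rec (∸-monoʳ-< ∣C∣<∣D∣ (∣p∣≤n D))) D∈F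
              (≤-trans 2≤∣C∣ (<⇒≤ ∣C∣<∣D∣) , D≢S) (λ x∈B → C⊆D (B⊆C x∈B))
      where
      ∣C∣<∣D∣ : ∣ C ∣ < ∣ D ∣
      ∣C∣<∣D∣ = p⊆q∧p≢q⇒∣p∣<∣q∣ (λ {x} → C⊆D {x}) C≢D

  maximals-meetAtMost1 : TwoLaminar F → AllPairs (MeetAtMost 1) maximals
  maximals-meetAtMost1 laminar =
    AllPairs-mapWith (λ (A∈ , maxA) (B∈ , maxB) → meet≤1 A∈ maxA B∈ maxB)
      (All.tabulate ∈-maximals⁻) (AllPairsₚ.filter⁺ maximal? (distinct F))
    where
    meet≤1 : ∀ {A B} → A ∈ sets F → Maximal A → B ∈ sets F → Maximal B → A ≢ B → MeetAtMost 1 A B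
    meet≤1 {A} {B} A∈F ((_ , A≢S) , A-top) B∈F ((_ , B≢S) , B-top) A≢B with 2 ≤? ∣ A ∩ B ∣
    ... | no  A∩B≱2 = s≤s⁻¹ (≰⇒> A∩B≱2)
    ... | yes A∩B≥2 with laminar A B A∈F B∈F A∩B≥2
    ...   | inj₁ A⊆B = contradiction (lose B∈F ((λ {x} → A⊆B {x}) , A≢B , B≢S)) A-top
    ...   | inj₂ B⊆A = contradiction (lose A∈F ((λ {x} → B⊆A {x}) , A≢B ∘ sym , A≢S)) B-top

module _ {n : ℕ} where

  countBig-∷-big : ∀ (B : Subset n) F → 2 ≤ ∣ B ∣ → countBig (B ∷ F) ≡ suc (countBig F)
  countBig-∷-big B F big with 2 ≤ᵇ ∣ B ∣ in eq
  ... | true  = refl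
  ... | false = contradiction (subst T eq (≤⇒≤ᵇ big)) id

  countBig-∷-small : ∀ (B : Subset n) F → ¬ 2 ≤ ∣ B ∣ → countBig (B ∷ F) ≡ countBig F
  countBig-∷-small B F small with 2 ≤ᵇ ∣ B ∣ in eq
  ... | true  = contradiction (≤ᵇ⇒≤ 2 ∣ B ∣ (subst T (sym eq) _)) small
  ... | false = refl

  countBig-∷-≤ : ∀ (B : Subset n) F → countBig (B ∷ F) ≤ suc (countBig F)
  countBig-∷-≤ B F with 2 ≤ᵇ ∣ B ∣
  ... | true  = ≤-refl
  ... | false = n≤1+n _

  countBig-∷-≥ : ∀ (B : Subset n) F → countBig F ≤ countBig (B ∷ F)
  countBig-∷-≥ B F with 2 ≤ᵇ ∣ B ∣
  ... | true  = n≤1+n _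
  ... | false = ≤-refl

  countBelow : List (Subset n) → Subset n → ℕ
  countBelow F A = countBig (filter (_⊆? A) F)

  countBelow-∷-≥ : ∀ (B : Subset n) F A → countBelow F A ≤ countBelow (B ∷ F) A
  countBelow-∷-≥ B F A with does (B ⊆? A)
  ... | true  = countBig-∷-≥ B (filter (_⊆? A) F)
  ... | false = ≤-refl

  sum-countBelow-∷-≥ : ∀ (B : Subset n) F M → sum (map (countBelow F) M) ≤ sum (map (countBelow (B ∷ F)) M)
  sum-countBelow-∷-≥ B F M = sum-map-mono-≤ {xs = M} (All.tabulate λ {A} _ → countBelow-∷-≥ B F A)

  countBelow-∷-⊆ : ∀ (B : Subset n) F {A} → B ⊆ A → 2 ≤ ∣ B ∣ → countBelow (B ∷ F) A ≡ suc (countBelow F A)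
  countBelow-∷-⊆ B F {A} B⊆A big with B ⊆? A
  ... | yes _    = countBig-∷-big B (filter (_⊆? A) F) big
  ... | no  B⊈A  = contradiction (λ {x} → B⊆A {x}) B⊈A

  countBig-∷-≤-countBelow : ∀ (M : List (Subset n)) {B F} c → (2 ≤ ∣ B ∣ → Any (B ⊆_) M) →
    countBig F ≤ c + sum (map (countBelow F) M) → countBig (B ∷ F) ≤ c + sum (map (countBelow (B ∷ F)) M)
  countBig-∷-≤-countBelow M {B} {F} c covered bound with 2 ≤? ∣ B ∣
  ... | yes big   = begin
    countBig (B ∷ F)                       ≡⟨ countBig-∷-big B F big ⟩
    suc (countBig F)                       ≤⟨ s≤s bound ⟩
    suc (c + sum (map (countBelow F) M))   ≡⟨ +-suc c _ ⟨
    c + suc (sum (map (countBelow F) M))   ≤⟨ +-monoʳ-≤ c (sum-map-mono-< {xs = M} (All.tabulate λ {A} _ → countBelow-∷-≥ B F A)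
                                               (Any.map (λ B⊆A → ≤-reflexive (sym (countBelow-∷-⊆ B F (λ {x} → B⊆A {x}) big)))
                                                        (covered big))) ⟩
    c + sum (map (countBelow (B ∷ F)) M)   ∎
    where open ≤-Reasoning
  ... | no  small = begin
    countBig (B ∷ F)                       ≡⟨ countBig-∷-small B F small ⟩
    countBig F                             ≤⟨ bound ⟩
    c + sum (map (countBelow F) M)         ≤⟨ +-monoʳ-≤ c (sum-countBelow-∷-≥ B F M) ⟩
    c + sum (map (countBelow (B ∷ F)) M)   ∎
    where open ≤-Reasoning

  countBig-≤-sum-countBelow : ∀ (M : List (Subset n)) F → (∀ {B} → B ∈ F → 2 ≤ ∣ B ∣ → Any (B ⊆_) M) →
    countBig F ≤ sum (map (countBelow F) M)
  countBig-≤-sum-countBelow M []      covered = z≤n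
  countBig-≤-sum-countBelow M (B ∷ F) covered =
    countBig-∷-≤-countBelow M 0 (covered (here refl)) (countBig-≤-sum-countBelow M F (covered ∘ there))

  countBig-≤-1+sum-countBelow : ∀ (S : Subset n) (M : List (Subset n)) {F} → Unique F →
    (∀ {B} → B ∈ F → 2 ≤ ∣ B ∣ → B ≢ S → Any (B ⊆_) M) →
    countBig F ≤ 1 + sum (map (countBelow F) M)
  countBig-≤-1+sum-countBelow S M {[]}    _          covered = z≤n
  countBig-≤-1+sum-countBelow S M {B ∷ F} (B∉F ∷ uF) covered with B ≟ₛ S
  ... | yes refl = begin
    countBig (B ∷ F)                       ≤⟨ countBig-∷-≤ B F ⟩
    suc (countBig F)                       ≤⟨ s≤s (countBig-≤-sum-countBelow M F covered-F) ⟩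
    suc (sum (map (countBelow F) M))       ≤⟨ s≤s (sum-countBelow-∷-≥ B F M) ⟩
    suc (sum (map (countBelow (B ∷ F)) M)) ∎
    where
    open ≤-Reasoning
    covered-F : ∀ {C} → C ∈ F → 2 ≤ ∣ C ∣ → Any (C ⊆_) M
    covered-F C∈F big = covered (there C∈F) big (λ C≡B → All.lookup B∉F C∈F (sym C≡B))
  ... | no  B≢S = countBig-∷-≤-countBelow M 1 (λ big → covered (here refl) big B≢S)
    (countBig-≤-1+sum-countBelow S M uF (λ C∈F → covered (there C∈F)))

toℚ≡mkℚ : ∀ k → toℚ k ≡ ℚ.mkℚ (ℤ.+ k) 0 (Coprime.sym (Coprime.1-coprimeTo k))
toℚ≡mkℚ k = ℚₚ.normalize-coprime (Coprime.sym (Coprime.1-coprimeTo k))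

toℚ-+ : ∀ a b → toℚ (a + b) ≡ toℚ a ℚ.+ toℚ b
toℚ-+ a b = begin
  ℤ.+ (a + b) ℚ./ 1                          ≡⟨ cong (ℚ._/ 1) (cong₂ ℤ._+_ (ℤₚ.*-identityʳ (ℤ.+ a)) (ℤₚ.*-identityʳ (ℤ.+ b))) ⟨
  (ℤ.+ a ℤ.* ℤ.+ 1 ℤ.+ ℤ.+ b ℤ.* ℤ.+ 1) ℚ./ 1  ≡⟨ cong₂ ℚ._+_ (toℚ≡mkℚ a) (toℚ≡mkℚ b) ⟨
  toℚ a ℚ.+ toℚ b                            ∎
  where open ≡-Reasoning

toℚ-mono-≤ : ∀ {a b} → a ≤ b → toℚ a ℚ.≤ toℚ b
toℚ-mono-≤ {a} {b} a≤b = subst₂ ℚ._≤_ (sym (toℚ≡mkℚ a)) (sym (toℚ≡mkℚ b))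
  (ℚ.*≤* (subst₂ ℤ._≤_ (sym (ℤₚ.*-identityʳ (ℤ.+ a))) (sym (ℤₚ.*-identityʳ (ℤ.+ b))) (ℤ.+≤+ a≤b)))

sumℚ : List ℚ → ℚ
sumℚ = foldr ℚ._+_ 0ℚ

toℚ-sum : ∀ ns → toℚ (sum ns) ≡ sumℚ (map toℚ ns)
toℚ-sum []       = refl
toℚ-sum (k ∷ ns) = trans (toℚ-+ k (sum ns)) (cong (toℚ k ℚ.+_) (toℚ-sum ns))

sumℚ-mono-≤ : ∀ {X : Set} {f h : X → ℚ} {xs} → All (λ x → f x ℚ.≤ h x) xs →
  sumℚ (map f xs) ℚ.≤ sumℚ (map h xs)
sumℚ-mono-≤ []         = ℚₚ.≤-refl
sumℚ-mono-≤ (le ∷ les) = ℚₚ.+-mono-≤ le (sumℚ-mono-≤ les)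

-- The objective of a multiset of sizes

sum2to-cong : ∀ m {u v : ℕ → ℚ} → (∀ k → u k ≡ v k) → sum2to m u ≡ sum2to m v
sum2to-cong zero          u≡v = refl
sum2to-cong (suc zero)    u≡v = refl
sum2to-cong (suc (suc j)) u≡v = cong₂ ℚ._+_ (sum2to-cong (suc j) u≡v) (u≡v (suc (suc j)))

sum2to-+ : ∀ m (u v : ℕ → ℚ) → sum2to m (λ k → u k ℚ.+ v k) ≡ sum2to m u ℚ.+ sum2to m v
sum2to-+ zero          u v = refl
sum2to-+ (suc zero)    u v = refl
sum2to-+ (suc (suc j)) u v =
  trans (cong (ℚ._+ (u (suc (suc j)) ℚ.+ v (suc (suc j)))) (sum2to-+ (suc j) u v))
        (ℚ-interchange (sum2to (suc j) u) (sum2to (suc j) v) _ _)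

sum2to-zero : ∀ m {u : ℕ → ℚ} → (∀ k → k ≤ m → u k ≡ 0ℚ) → sum2to m u ≡ 0ℚ
sum2to-zero zero          u≡0 = refl
sum2to-zero (suc zero)    u≡0 = refl
sum2to-zero (suc (suc j)) u≡0 =
  cong₂ ℚ._+_ (sum2to-zero (suc j) (λ k k≤ → u≡0 k (m≤n⇒m≤1+n k≤))) (u≡0 (suc (suc j)) ≤-refl)

δ : ℕ → ℕ → ℕ
δ k s = if k ≡ᵇ s then 1 else 0

δ-diag : ∀ s → δ s s ≡ 1
δ-diag zero    = refl
δ-diag (suc s) = δ-diag s

δ-≢ : ∀ {k s} → k ≢ s → δ k s ≡ 0
δ-≢ {k} {s} k≢s with k ≡ᵇ s in eq
... | true  = contradiction (≡ᵇ⇒≡ k s (subst T (sym eq) _)) k≢s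
... | false = refl

δ-term-vanishes : ∀ (h : ℕ → ℚ) {k s} → k ≢ s → h k ℚ.* toℚ (δ k s) ≡ 0ℚ
δ-term-vanishes h {k} k≢s = trans (cong (λ d → h k ℚ.* toℚ d) (δ-≢ k≢s)) (ℚₚ.*-zeroʳ (h k))

sum2to-δ-last : ∀ j (h : ℕ → ℚ) → sum2to (suc (suc j)) (λ k → h k ℚ.* toℚ (δ k (suc (suc j)))) ≡ h (suc (suc j))
sum2to-δ-last j h = begin
  sum2to (suc j) (λ k → h k ℚ.* toℚ (δ k m)) ℚ.+ h m ℚ.* toℚ (δ m m)
    ≡⟨ cong₂ ℚ._+_ (sum2to-zero (suc j) (λ k k≤ → δ-term-vanishes h (<⇒≢ (s≤s k≤))))
                   (cong (λ d → h m ℚ.* toℚ d) (δ-diag m)) ⟩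
  0ℚ ℚ.+ h m ℚ.* 1ℚ
    ≡⟨ trans (ℚₚ.+-identityˡ _) (ℚₚ.*-identityʳ (h m)) ⟩
  h m ∎
  where
  open ≡-Reasoning
  m = suc (suc j)

sum2to-δ : ∀ m (h : ℕ → ℚ) {s} → 2 ≤ s → s ≤ m → sum2to m (λ k → h k ℚ.* toℚ (δ k s)) ≡ h s
sum2to-δ zero          h 2≤s s≤m = contradiction (≤-trans 2≤s s≤m) λ ()
sum2to-δ (suc zero)    h 2≤s s≤m = contradiction (≤-trans 2≤s s≤m) λ { (s≤s ()) }
sum2to-δ (suc (suc j)) h {s} 2≤s s≤m =
  [ (λ s<m → trans (cong (sum2to (suc j) (λ k → h k ℚ.* toℚ (δ k s)) ℚ.+_) (δ-term-vanishes h (>⇒≢ s<m)))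
                   (trans (ℚₚ.+-identityʳ _) (sum2to-δ (suc j) h 2≤s (s≤s⁻¹ s<m))))
  , (λ s≡m → subst (λ s → sum2to (suc (suc j)) (λ k → h k ℚ.* toℚ (δ k s)) ≡ h s)
                   (sym s≡m) (sum2to-δ-last j h))
  ] (m≤n⇒m<n∨m≡n s≤m)

-- A list L of sizes is read as the point b_k = multiplicity L k of the linear program.
multiplicity : List ℕ → ℕ → ℕ
multiplicity []      k = 0
multiplicity (s ∷ L) k = δ k s + multiplicity L k

multiplicity-pos : ∀ {m L} → m ∈ L → 1 ≤ multiplicity L m
multiplicity-pos {m} {s ∷ L} (here refl) = ≤-trans (≤-reflexive (sym (δ-diag m))) (m≤m+n _ _)
multiplicity-pos {m} {s ∷ L} (there m∈L) = ≤-trans (multiplicity-pos m∈L) (m≤n+m _ (δ m s))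

objective-multiplicity : ∀ (h : ℕ → ℚ) {m L} → All (λ s → 2 ≤ s × s ≤ m) L →
  Objective h m (toℚ ∘ multiplicity L) ≡ sumℚ (map h L)
objective-multiplicity h {m} []                       = sum2to-zero m (λ k _ → ℚₚ.*-zeroʳ (h k))
objective-multiplicity h {m} {s ∷ L} ((2≤s , s≤m) ∷ bounds) = begin
  sum2to m (λ k → h k ℚ.* toℚ (δ k s + multiplicity L k))
    ≡⟨ sum2to-cong m (λ k → trans (cong (h k ℚ.*_) (toℚ-+ (δ k s) _)) (ℚₚ.*-distribˡ-+ (h k) _ _)) ⟩
  sum2to m (λ k → h k ℚ.* toℚ (δ k s) ℚ.+ h k ℚ.* toℚ (multiplicity L k))
    ≡⟨ sum2to-+ m _ _ ⟩
  sum2to m (λ k → h k ℚ.* toℚ (δ k s)) ℚ.+ Objective h m (toℚ ∘ multiplicity L)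
    ≡⟨ cong₂ ℚ._+_ (sum2to-δ m h 2≤s s≤m) (objective-multiplicity h bounds) ⟩
  h s ℚ.+ sumℚ (map h L) ∎
  where open ≡-Reasoning

sumℚ-map-toℚ : ∀ {X : Set} (f : X → ℕ) xs → sumℚ (map (toℚ ∘ f) xs) ≡ toℚ (sum (map f xs))
sumℚ-map-toℚ f xs = trans (cong sumℚ (map-∘ xs)) (sym (toℚ-sum (map f xs)))

objective-toℚ : ∀ (f : ℕ → ℕ) {m L} → All (λ s → 2 ≤ s × s ≤ m) L →
  Objective (toℚ ∘ f) m (toℚ ∘ multiplicity L) ≡ toℚ (sum (map f L))
objective-toℚ f {L = L} bounds = trans (objective-multiplicity (toℚ ∘ f) bounds) (sumℚ-map-toℚ f L)

-- Bounds on f̄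

module _ (fbar : ℕ → ℚ) (isFbar : IsFbar fbar) where

  private
    fbar2 : fbar 2 ≡ 1ℚ
    fbar2 = proj₁ isFbar

    fbar3 : fbar 3 ≡ toℚ 4
    fbar3 = proj₁ (proj₂ isFbar)

    fbar-max : ∀ k → 3 < k → ∀ m → 2 ≤ m → m < k → ∀ b → Feasible k m b → 1ℚ ℚ.+ Objective fbar m b ℚ.≤ fbar k
    fbar-max k 3<k = proj₂ (proj₂ (proj₂ isFbar) k 3<k)

  1+sum≤fbar : ∀ k → 3 ≤ k → ∀ L {m} → m ∈ L → All (λ s → 2 ≤ s × s ≤ m) L → m < k →
    sum (map (_C 2) L) ≤ k C 2 →
    sum (map (λ s → (s ∸ 1) C 2) L) ≤ (k ∸ m) C 2 + (m ∸ 1) C 2 →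
    1ℚ ℚ.+ sumℚ (map fbar L) ℚ.≤ fbar k
  1+sum≤fbar 0 ()
  1+sum≤fbar 1 (s≤s ())
  1+sum≤fbar 2 (s≤s (s≤s ()))
  -- f̄(3) is not given by the linear program; here every size is 2 and f̄(2) = 1 = C(2,2).
  1+sum≤fbar 3 _ L m∈L bounds m<3 pairs _ = begin
    1ℚ ℚ.+ sumℚ (map fbar L)            ≡⟨ cong (λ xs → 1ℚ ℚ.+ sumℚ xs) (map-cong-local (All.map size2 bounds)) ⟩
    1ℚ ℚ.+ sumℚ (map (toℚ ∘ (_C 2)) L)  ≡⟨ cong (1ℚ ℚ.+_) (sumℚ-map-toℚ (_C 2) L) ⟩
    1ℚ ℚ.+ toℚ (sum (map (_C 2) L))     ≡⟨ toℚ-+ 1 (sum (map (_C 2) L)) ⟨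
    toℚ (1 + sum (map (_C 2) L))        ≤⟨ toℚ-mono-≤ (s≤s pairs) ⟩
    toℚ 4                               ≡⟨ fbar3 ⟨
    fbar 3                              ∎
    where
    open ℚₚ.≤-Reasoning
    size2 : ∀ {s} → 2 ≤ s × s ≤ _ → fbar s ≡ toℚ (s C 2)
    size2 (2≤s , s≤m) with ≤-antisym (≤-trans s≤m (s≤s⁻¹ m<3)) 2≤s
    ... | refl = fbar2
  1+sum≤fbar k@(suc (suc (suc (suc _)))) _ L {m} m∈L bounds m<k pairs residual =
    subst (ℚ._≤ fbar k) (cong (1ℚ ℚ.+_) (objective-multiplicity fbar bounds))
      (fbar-max k (s≤s (s≤s (s≤s (s≤s z≤n)))) m (proj₁ (All.lookup bounds m∈L)) m<k
        (toℚ ∘ multiplicity L) feasible)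
    where
    feasible : Feasible k m (toℚ ∘ multiplicity L)
    feasible = toℚ-mono-≤ (multiplicity-pos m∈L)
             , (λ j _ _ → toℚ-mono-≤ {0} {multiplicity L j} z≤n)
             , subst (ℚ._≤ toℚ (k C 2)) (sym (objective-toℚ (_C 2) bounds)) (toℚ-mono-≤ pairs)
             , subst₂ ℚ._≤_ (sym (objective-toℚ (λ s → (s ∸ 1) C 2) bounds))
                            (toℚ-+ ((k ∸ m) C 2) ((m ∸ 1) C 2)) (toℚ-mono-≤ residual)

  1≤fbar : ∀ {k} → 2 ≤ k → 1ℚ ℚ.≤ fbar k
  1≤fbar {k} 2≤k with m≤n⇒m<n∨m≡n 2≤k
  ... | inj₂ refl = ℚₚ.≤-reflexive (sym fbar2)
  ... | inj₁ 2<k  = ℚₚ.≤-trans 1≤1+fbar2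
    (1+sum≤fbar k 2<k (2 ∷ []) (here refl) ((≤-refl , ≤-refl) ∷ []) 2<k (C-monoˡ-≤ 2 2≤k) z≤n)
    where
    1≤1+fbar2 : 1ℚ ℚ.≤ 1ℚ ℚ.+ (fbar 2 ℚ.+ 0ℚ)
    1≤1+fbar2 = subst (λ x → 1ℚ ℚ.≤ 1ℚ ℚ.+ (x ℚ.+ 0ℚ)) (sym fbar2) (toℚ-mono-≤ {1} {2} (s≤s z≤n))

  1+sum≤fbar-linear : ∀ {n} (S : Subset n) → 2 ≤ ∣ S ∣ → ∀ {M} → AllPairs (MeetAtMost 1) M → All (_⊆ S) M →
    All (λ A → 2 ≤ ∣ A ∣ × ∣ A ∣ < ∣ S ∣) M → 1ℚ ℚ.+ sumℚ (map (fbar ∘ ∣_∣) M) ℚ.≤ fbar ∣ S ∣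
  1+sum≤fbar-linear S 2≤∣S∣ {[]} _ _ _ = subst (ℚ._≤ fbar ∣ S ∣) (sym (ℚₚ.+-identityʳ 1ℚ)) (1≤fbar 2≤∣S∣)
  1+sum≤fbar-linear S _ {A₀ ∷ M} meet M⊆S sizes =
    subst (λ xs → 1ℚ ℚ.+ sumℚ xs ℚ.≤ fbar ∣ S ∣) (sym (map-∘ {g = fbar} {f = ∣_∣} (A₀ ∷ M)))
      (1+sum≤fbar ∣ S ∣ (≤-trans (s≤s 2≤∣A₁∣) ∣A₁∣<∣S∣) (map ∣_∣ (A₀ ∷ M)) (∈-map⁺ ∣_∣ A₁∈) bounds ∣A₁∣<∣S∣
        (subst (_≤ ∣ S ∣ C 2) (cong sum (map-∘ (A₀ ∷ M))) (packing-bound 1 S meet M⊆S))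
        (subst (_≤ (∣ S ∣ ∸ ∣ A₁ ∣) C 2 + (∣ A₁ ∣ ∸ 1) C 2) (cong sum (map-∘ (A₀ ∷ M)))
               (residual-packing-bound S meet M⊆S A₁∈)))
    where
    A₁ : Subset _
    A₁ = argmax ∣_∣ A₀ M
    A₁∈ : A₁ ∈ A₀ ∷ M
    A₁∈ = argmax-all ∣_∣ {P = _∈ A₀ ∷ M} (here refl) (All.tabulate there)
    2≤∣A₁∣ : 2 ≤ ∣ A₁ ∣
    2≤∣A₁∣ = proj₁ (All.lookup sizes A₁∈)
    ∣A₁∣<∣S∣ : ∣ A₁ ∣ < ∣ S ∣
    ∣A₁∣<∣S∣ = proj₂ (All.lookup sizes A₁∈)
    bounds : All (λ s → 2 ≤ s × s ≤ ∣ A₁ ∣) (map ∣_∣ (A₀ ∷ M))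
    bounds = Allₚ.map⁺ (All.zipWith (λ ((2≤∣A∣ , _) , ∣A∣≤∣A₁∣) → 2≤∣A∣ , ∣A∣≤∣A₁∣)
                                    (sizes , f[⊥]≤f[argmax] {f = ∣_∣} A₀ M ∷ f[xs]≤f[argmax] A₀ M))

  bigCount≤fbar : ∀ {n} (S : Subset n) → Acc _<_ ∣ S ∣ → 2 ≤ ∣ S ∣ → (F : Family n) → TwoLaminar F →
    All (_⊆ S) (sets F) → toℚ (bigCount F) ℚ.≤ fbar ∣ S ∣
  bigCount≤fbar S (acc rec) 2≤∣S∣ F laminar F⊆S = begin
    toℚ (bigCount F)
      ≤⟨ toℚ-mono-≤ (countBig-≤-1+sum-countBelow S maximals (distinct F) covered) ⟩
    toℚ (1 + sum (map (countBelow (sets F)) maximals))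
      ≡⟨ trans (toℚ-+ 1 (sum (map (countBelow (sets F)) maximals)))
               (cong (1ℚ ℚ.+_) (sym (sumℚ-map-toℚ (countBelow (sets F)) maximals))) ⟩
    1ℚ ℚ.+ sumℚ (map (toℚ ∘ countBelow (sets F)) maximals)
      ≤⟨ ℚₚ.+-monoʳ-≤ 1ℚ (sumℚ-mono-≤ (All.tabulate below-bound)) ⟩
    1ℚ ℚ.+ sumℚ (map (fbar ∘ ∣_∣) maximals)
      ≤⟨ 1+sum≤fbar-linear S 2≤∣S∣ (maximals-meetAtMost1 laminar) (All.map proj₁ (All.tabulate sizes))
                                   (All.map proj₂ (All.tabulate sizes)) ⟩
    fbar ∣ S ∣ ∎
    where
    open ℚₚ.≤-Reasoning
    open MaximalMembers S F
    covered : ∀ {B} → B ∈ sets F → 2 ≤ ∣ B ∣ → B ≢ S → Any (B ⊆_) maximals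
    covered B∈F big B≢S = below-maximal B∈F (big , B≢S)
    sizes : ∀ {A} → A ∈ maximals → A ⊆ S × 2 ≤ ∣ A ∣ × ∣ A ∣ < ∣ S ∣
    sizes A∈ with ∈-maximals⁻ A∈
    ... | A∈F , (2≤∣A∣ , A≢S) , _ = A⊆S , 2≤∣A∣ , p⊆q∧p≢q⇒∣p∣<∣q∣ (λ {x} → A⊆S {x}) A≢S
      where
      A⊆S = All.lookup F⊆S A∈F
    below-bound : ∀ {A} → A ∈ maximals → toℚ (countBelow (sets F) A) ℚ.≤ fbar ∣ A ∣
    below-bound {A} A∈ with sizes A∈
    ... | _ , 2≤∣A∣ , ∣A∣<∣S∣ = bigCount≤fbar A (rec ∣A∣<∣S∣) 2≤∣A∣ (F ↾ A) (↾-twoLaminar {F = F} laminar) (↾-⊆ F)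

proposition3p5 : (fbar : ℕ → ℚ) → IsFbar fbar →
    ∀ n → 2 < n → (F : Family n) → TwoLaminar F → toℚ (bigCount F) ℚ.≤ fbar n
proposition3p5 fbar isFbar n 2<n F laminar =
  subst (λ k → toℚ (bigCount F) ℚ.≤ fbar k) (∣⊤∣≡n n)
    (bigCount≤fbar fbar isFbar (⊤ {n}) (<-wellFounded _) (subst (2 ≤_) (sym (∣⊤∣≡n n)) (<⇒≤ 2<n))
      F laminar (All.tabulate (λ _ {x} → ⊆⊤ {x = x})))
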